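{- Let $G$ be a $3$-connected graph in $\mathcal{G}_2$, and let $H$ be a proper induced subgraph of $G$ with at least $3$ vertices such that each vertex of $V(G)\setminus V(H)$ has at most one neighbor in $H$. Then $H$ has a strong induced ear of length at least $3$ whose two attachments are nonadjacent.
   Context: All graphs are finite and simple. A hole is an induced cycle of length at least $4$; an odd hole is a hole of odd length. $\mathcal{G}_2$ is the family of graphs of girth exactly $5$ having no odd holes of length at least $7$. For a proper induced subgraph $H$ of $G$, an ear of $H$ is a path $F$ in $G$ connecting two vertices of $H$ all of whose internal vertices lie in $V(G)\setminus V(H)$; its two end vertices are its attachments. An ear is induced if it is an induced path of $G$. An induced ear $F$ with attachments $x,y$ is strong if every edge of $G[V(H)\cup V(F)]$ that is neither an edge of $H$ nor an edge of $F$ joins a common neighbor of $x$ and $y$ in $H$ to an internal vertex of $F$. -}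

module Defs where

open import Data.Nat using (ℕ; zero; suc; _≤_; _<_; _+_)
open import Data.Fin using (Fin; toℕ; inject₁; fromℕ) renaming (zero to fzero; suc to fsuc)
open import Data.Fin.Subset using (Subset; _∈_; _∉_; ∣_∣)
open import Data.Bool using (Bool; true; false)
open import Data.Product using (Σ; ∃; _×_; _,_)
open import Data.Sum using (_⊎_)
open import Relation.Binary.PropositionalEquality using (_≡_; _≢_)
open import Relation.Nullary using (¬_)
open import Function.Definitions using (Injective)

record Graph : Set where
  field
    n     : ℕ
    adj   : Fin n → Fin n → Bool
    sym   : ∀ u v → adj u v ≡ adj v u
    irrefl : ∀ v → adj v v ≡ false

open Graph public

V : Graph → Set
V G = Fin (n G)

Edge : (G : Graph) → V G → V G → Set
Edge G u v = adj G u v ≡ true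

CycSucc : ∀ {k} → Fin k → Fin k → Set
CycSucc {k} i j = (suc (toℕ i) ≡ toℕ j) ⊎ ((suc (toℕ i) ≡ k) × (toℕ j ≡ 0))

record Cycle (G : Graph) (k : ℕ) : Set where
  field
    len≥3 : 3 ≤ k
    vert  : Fin k → V G
    inj   : Injective _≡_ _≡_ vert
    edges : ∀ i j → CycSucc i j → Edge G (vert i) (vert j)

record Hole (G : Graph) (k : ℕ) : Set where
  field
    cycle   : Cycle G k
    len≥4   : 4 ≤ k
    induced : ∀ i j → Edge G (Cycle.vert cycle i) (Cycle.vert cycle j) →
              CycSucc i j ⊎ CycSucc j i

Odd : ℕ → Set
Odd k = Σ ℕ λ m → k ≡ suc (m + m)

GirthFive : Graph → Set
GirthFive G = Cycle G 5 × (∀ k → k < 5 → ¬ Cycle G k)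

InG2 : Graph → Set
InG2 G = GirthFive G × (∀ k → 7 ≤ k → Odd k → ¬ Hole G k)

record WalkAvoiding (G : Graph) (X : Subset (n G)) (u v : V G) : Set where
  field
    m      : ℕ
    vert   : Fin (suc m) → V G
    start  : vert fzero ≡ u
    end    : vert (fromℕ m) ≡ v
    steps  : ∀ (i : Fin m) → Edge G (vert (inject₁ i)) (vert (fsuc i))
    avoid  : ∀ i → vert i ∉ X

ConnectedMinus : (G : Graph) → Subset (n G) → Set
ConnectedMinus G X = ∀ u v → u ∉ X → v ∉ X → WalkAvoiding G X u v

KConnected : ℕ → Graph → Set
KConnected k G = (k < n G) × (∀ (X : Subset (n G)) → ∣ X ∣ < k → ConnectedMinus G X)

record Path (G : Graph) : Set where
  field
    m     : ℕ
    vert  : Fin (suc m) → V G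
    inj   : Injective _≡_ _≡_ vert
    steps : ∀ (i : Fin m) → Edge G (vert (inject₁ i)) (vert (fsuc i))

  first : V G
  first = vert fzero

  last : V G
  last = vert (fromℕ m)

  Internal : Fin (suc m) → Set
  Internal i = (toℕ i ≢ 0) × (toℕ i ≢ m)

  OnPath : V G → Set
  OnPath v = ∃ λ i → vert i ≡ v

  InternalVertex : V G → Set
  InternalVertex v = ∃ λ i → Internal i × (vert i ≡ v)

  PathEdge : V G → V G → Set
  PathEdge u v = ∃ λ i → ∃ λ j → (suc (toℕ i) ≡ toℕ j ⊎ suc (toℕ j) ≡ toℕ i)
                   × (vert i ≡ u) × (vert j ≡ v)

  IsInduced : Set
  IsInduced = ∀ i j → Edge G (vert i) (vert j) →
              suc (toℕ i) ≡ toℕ j ⊎ suc (toℕ j) ≡ toℕ i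

open Path public using (first; last; Internal; OnPath; InternalVertex; PathEdge; IsInduced)

IsEar : (G : Graph) → Subset (n G) → Path G → Set
IsEar G S F = (first F ∈ S) × (last F ∈ S) ×
              (∀ i → Internal F i → Path.vert F i ∉ S)

earLength : ∀ {G} → Path G → ℕ
earLength F = Path.m F

IsStrongInducedEar : (G : Graph) → Subset (n G) → Path G → Set
IsStrongInducedEar G S F =
  IsEar G S F × IsInduced F ×
  (∀ u v → (u ∈ S ⊎ OnPath F u) → (v ∈ S ⊎ OnPath F v) → Edge G u v →
     ¬ (u ∈ S × v ∈ S) → ¬ PathEdge F u v →
     ((u ∈ S × Edge G u (first F) × Edge G u (last F)) × InternalVertex F v)
     ⊎ ((v ∈ S × Edge G v (first F) × Edge G v (last F)) × InternalVertex F u))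

{-# OPTIONS --safe #-}
module Submission where

-- Starting outside H, 3-connectivity applied three times (each time deleting the attachments
-- found so far) gives walks outside H reaching distinct vertices x₁, x₂, x₃ of H, each walk
-- continuing the previous one. As G has no triangle, two of the xᵢ are nonadjacent, which
-- yields an ear walk: a walk between distinct nonadjacent vertices of H with interior outside H.
-- A shortest ear walk is a strong induced ear: a repeated vertex or a chord can be cut out, and a
-- vertex z of H adjacent to an interior vertex e k but not to the end e 0 gives the shorter ear
-- walk e 0 … e k z (symmetrically at the other end). As the interior vertex e k has at most one
-- neighbour in H, this walk is indeed shorter, and every ear walk has length at least 3.

open import Defs hiding (sym)
import Data.Bool as Bool
open import Data.Fin using (Fin; toℕ; inject₁; fromℕ; fromℕ<) renaming (zero to fzero; suc to fsuc)
open import Data.Fin.Patterns using (0F; 1F; 2F)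
open import Data.Fin.Properties
  using (toℕ-fromℕ; toℕ-fromℕ<; toℕ<n; toℕ≤pred[n]; toℕ-inject₁; toℕ-injective; ¬∀⟶∃¬; any?)
  renaming (_≟_ to _≟ᶠ_)
open import Data.Fin.Subset using (Subset; _∈_; _∉_; ∣_∣; _⊆_; ⊥; ⁅_⁆; _∪_; inside; outside)
open import Data.Fin.Subset.Properties
  using (_∈?_; ∉⊥; ∣⊥∣≡0; ∣⁅x⁆∣≡1; x∈⁅x⁆; x∈⁅y⁆⇒x≡y; x∈p∪q⁻; x∈p∪q⁺; p⊆q⇒∣p∣≤∣q∣)
open import Data.Nat using (ℕ; zero; suc; _+_; _∸_; _≤_; _<_; z≤n; s≤s; z<s; _≤?_; _<?_; _≟_)
open import Data.Nat.Induction using (<-rec)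
open import Data.Nat.Properties
open import Data.Nat.Tactic.RingSolver using (solve-∀)
open import Data.Product using (Σ; ∃; _×_; _,_; swap)
open import Data.Sum using (_⊎_; inj₁; inj₂; [_,_])
import Data.Sum as Sum
open import Data.Vec using (_∷_; [])
open import Function using (_∘_; flip)
open import Relation.Binary.PropositionalEquality using (_≡_; _≢_; refl; sym; trans; cong; cong₂; subst; subst₂)
open import Relation.Binary using (tri<; tri≈; tri>)
open import Relation.Nullary using (¬_; Dec; yes; no; contradiction; _×-dec_; _⊎-dec_; _→-dec_; ¬?)
open import Relation.Nullary.Decidable using (decidable-stable)

joinAt : {A : Set} → ℕ → (ℕ → A) → (ℕ → A) → ℕ → A
joinAt k f g t with t ≤? k
... | yes _ = f t
... | no _  = g t

module _ {A : Set} (k : ℕ) (f g : ℕ → A) where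

  joinAt-≤ : ∀ {t} → t ≤ k → joinAt k f g t ≡ f t
  joinAt-≤ {t} t≤k with t ≤? k
  ... | yes _  = refl
  ... | no t≰k = contradiction t≤k t≰k

  joinAt-> : ∀ {t} → k < t → joinAt k f g t ≡ g t
  joinAt-> {t} k<t with t ≤? k
  ... | yes t≤k = contradiction t≤k (<⇒≱ k<t)
  ... | no _    = refl

_◂_ : {A : Set} → A → (ℕ → A) → ℕ → A
(x ◂ f) zero    = x
(x ◂ f) (suc t) = f t

first-entry : {P : ℕ → Set} → (∀ t → Dec (P t)) → ¬ P 0 → ∀ m → P m →
              ∃ λ j → j < m × (∀ t → t ≤ j → ¬ P t) × P (suc j)
first-entry P? ¬P0 zero    Pm = contradiction Pm ¬P0
first-entry P? ¬P0 (suc m) Pm with P? 1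
... | yes P1 = 0 , z<s , (λ { zero _ → ¬P0 }) , P1
... | no ¬P1 with first-entry (P? ∘ suc) ¬P1 m Pm
...   | j , j<m , before , Pj+1 =
  suc j , s≤s j<m , (λ { zero _ → ¬P0 ; (suc t) (s≤s t≤j) → before t t≤j }) , Pj+1

clamp : ∀ m → ℕ → Fin (suc m)
clamp m       zero    = fzero
clamp zero    (suc t) = fzero
clamp (suc m) (suc t) = fsuc (clamp m t)

clamp-toℕ : ∀ m (i : Fin (suc m)) → clamp m (toℕ i) ≡ i
clamp-toℕ m       fzero    = refl
clamp-toℕ (suc m) (fsuc i) = cong fsuc (clamp-toℕ m i)

clamp-inject₁ : ∀ {m} (i : Fin m) → clamp m (toℕ i) ≡ inject₁ i
clamp-inject₁ {suc m} fzero    = refl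
clamp-inject₁ {suc m} (fsuc i) = cong fsuc (clamp-inject₁ i)

clamp-diag : ∀ m → clamp m m ≡ fromℕ m
clamp-diag zero    = refl
clamp-diag (suc m) = cong fsuc (clamp-diag m)

∣p∣<∣q∣⇒∃∈q∉p : ∀ {k} {p q : Subset k} → ∣ p ∣ < ∣ q ∣ → ∃ λ x → x ∈ q × x ∉ p
∣p∣<∣q∣⇒∃∈q∉p {k} {p} {q} ∣p∣<∣q∣
  with ¬∀⟶∃¬ k (λ x → x ∈ q → x ∈ p) (λ x → x ∈? q →-dec x ∈? p)
         (λ q⊆p → <⇒≱ ∣p∣<∣q∣ (p⊆q⇒∣p∣≤∣q∣ (q⊆p _)))
... | x , x∈q⇏x∈p =
  x , decidable-stable (x ∈? q) (λ x∉q → x∈q⇏x∈p (λ x∈q → contradiction x∈q x∉q))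
    , λ x∈p → x∈q⇏x∈p (λ _ → x∈p)

∣p∪q∣≤∣p∣+∣q∣ : ∀ {k} (p q : Subset k) → ∣ p ∪ q ∣ ≤ ∣ p ∣ + ∣ q ∣
∣p∪q∣≤∣p∣+∣q∣ []            []            = z≤n
∣p∪q∣≤∣p∣+∣q∣ (inside  ∷ p) (inside  ∷ q) = s≤s (≤-trans (∣p∪q∣≤∣p∣+∣q∣ p q) (+-monoʳ-≤ ∣ p ∣ (n≤1+n ∣ q ∣)))
∣p∪q∣≤∣p∣+∣q∣ (inside  ∷ p) (outside ∷ q) = s≤s (∣p∪q∣≤∣p∣+∣q∣ p q)
∣p∪q∣≤∣p∣+∣q∣ (outside ∷ p) (inside  ∷ q) =
  subst (∣ p ∪ q ∣ <_) (sym (+-suc ∣ p ∣ ∣ q ∣)) (s≤s (∣p∪q∣≤∣p∣+∣q∣ p q))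
∣p∪q∣≤∣p∣+∣q∣ (outside ∷ p) (outside ∷ q) = ∣p∪q∣≤∣p∣+∣q∣ p q

x∈p⇒⁅x⁆⊆p : ∀ {k} {x : Fin k} {p} → x ∈ p → ⁅ x ⁆ ⊆ p
x∈p⇒⁅x⁆⊆p {x = x} {p} x∈p y∈⁅x⁆ = subst (_∈ p) (sym (x∈⁅y⁆⇒x≡y x y∈⁅x⁆)) x∈p

p⊆r∧q⊆r⇒p∪q⊆r : ∀ {k} {p q r : Subset k} → p ⊆ r → q ⊆ r → p ∪ q ⊆ r
p⊆r∧q⊆r⇒p∪q⊆r {p = p} {q} p⊆r q⊆r x∈p∪q = [ p⊆r , q⊆r ] (x∈p∪q⁻ p q x∈p∪q)

x∉⁅y⁆⇒y≢x : ∀ {k} {x y : Fin k} → x ∉ ⁅ y ⁆ → y ≢ x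
x∉⁅y⁆⇒y≢x {x = x} x∉⁅y⁆ refl = x∉⁅y⁆ (x∈⁅x⁆ x)

x∉⁅y⁆∪⁅z⁆⇒y≢x×z≢x : ∀ {k} {x y z : Fin k} → x ∉ ⁅ y ⁆ ∪ ⁅ z ⁆ → y ≢ x × z ≢ x
x∉⁅y⁆∪⁅z⁆⇒y≢x×z≢x x∉⁅y⁆∪⁅z⁆ =
  x∉⁅y⁆⇒y≢x (x∉⁅y⁆∪⁅z⁆ ∘ x∈p∪q⁺ ∘ inj₁) , x∉⁅y⁆⇒y≢x (x∉⁅y⁆∪⁅z⁆ ∘ x∈p∪q⁺ ∘ inj₂)

∣⁅x⁆∪⁅y⁆∣≤2 : ∀ {k} (x y : Fin k) → ∣ ⁅ x ⁆ ∪ ⁅ y ⁆ ∣ ≤ 2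
∣⁅x⁆∪⁅y⁆∣≤2 x y =
  subst (∣ ⁅ x ⁆ ∪ ⁅ y ⁆ ∣ ≤_) (cong₂ _+_ (∣⁅x⁆∣≡1 x) (∣⁅x⁆∣≡1 y)) (∣p∪q∣≤∣p∣+∣q∣ ⁅ x ⁆ ⁅ y ⁆)

module _ (G : Graph) where

  Edge-sym : ∀ {u v} → Edge G u v → Edge G v u
  Edge-sym {u} {v} = trans (Graph.sym G v u)

  Edge-irrefl : ∀ {v} → ¬ Edge G v v
  Edge-irrefl {v} v~v with trans (sym (irrefl G v)) v~v
  ... | ()

  Edge? : ∀ u v → Dec (Edge G u v)
  Edge? u v = adj G u v Bool.≟ Bool.true

  triangle : ∀ {x y z} → x ≢ y → y ≢ z → x ≢ z →
             Edge G x y → Edge G y z → Edge G x z → Cycle G 3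
  triangle {x} {y} {z} x≢y y≢z x≢z x~y y~z x~z =
    record { len≥3 = ≤-refl ; vert = vertex ; inj = injective _ _ ; edges = edge }
    where
    vertex : Fin 3 → V G
    vertex 0F = x
    vertex 1F = y
    vertex 2F = z

    injective : ∀ i j → vertex i ≡ vertex j → i ≡ j
    injective 0F 0F _   = refl
    injective 0F 1F x≡y = contradiction x≡y x≢y
    injective 0F 2F x≡z = contradiction x≡z x≢z
    injective 1F 0F y≡x = contradiction (sym y≡x) x≢y
    injective 1F 1F _   = refl
    injective 1F 2F y≡z = contradiction y≡z y≢z
    injective 2F 0F z≡x = contradiction (sym z≡x) x≢z
    injective 2F 1F z≡y = contradiction (sym z≡y) y≢z
    injective 2F 2F _   = refl

    edge : ∀ i j → CycSucc i j → Edge G (vertex i) (vertex j)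
    edge 0F 1F _ = x~y
    edge 1F 2F _ = y~z
    edge 2F 0F _ = Edge-sym x~z
    edge 0F 0F (inj₁ ())
    edge 0F 0F (inj₂ (() , _))
    edge 0F 2F (inj₁ ())
    edge 0F 2F (inj₂ (() , _))
    edge 1F 0F (inj₁ ())
    edge 1F 0F (inj₂ (() , _))
    edge 1F 1F (inj₁ ())
    edge 1F 1F (inj₂ (() , _))
    edge 2F 1F (inj₁ ())
    edge 2F 1F (inj₂ (_ , ()))
    edge 2F 2F (inj₁ ())
    edge 2F 2F (inj₂ (_ , ()))

AtMostOneNeighbourIn : (G : Graph) → Subset (n G) → Set
AtMostOneNeighbourIn G S =
  ∀ v → v ∉ S → ∀ a b → a ∈ S → b ∈ S → Edge G v a → Edge G v b → a ≡ b

-- Ear walks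

module Ears (G : Graph) (S : Subset (n G)) where

  -- The walk e 0, …, e M; the values of e beyond M are irrelevant.
  record EarWalk (e : ℕ → V G) (M : ℕ) : Set where
    field
      start∈S          : e 0 ∈ S
      end∈S            : e M ∈ S
      ends-distinct    : e 0 ≢ e M
      ends-nonadjacent : ¬ Edge G (e 0) (e M)
      interior∉S       : ∀ t → 0 < t → t < M → e t ∉ S
      steps            : ∀ t → t < M → Edge G (e t) (e (suc t))

  EarWalkShorterThan : ℕ → Set
  EarWalkShorterThan M = ∃ λ e → ∃ λ M′ → M′ < M × EarWalk e M′

  Chord : (ℕ → V G) → ℕ → Set
  Chord e M = ∃ λ j → j < M × ∃ λ i → i < j × Edge G (e i) (e (suc j))

  StrayNeighbour : (ℕ → V G) → ℕ → Set
  StrayNeighbour e M = ∃ λ k → k < M × 0 < k × ∃ λ z → z ∈ S × Edge G z (e k) ×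
    z ≢ e 0 × z ≢ e M × (¬ Edge G z (e 0) ⊎ ¬ Edge G z (e M))

  chord? : ∀ e M → Dec (Chord e M)
  chord? e = anyUpTo? (λ j → anyUpTo? (λ i → Edge? G (e i) (e (suc j))) j)

  strayNeighbour? : ∀ e M → Dec (StrayNeighbour e M)
  strayNeighbour? e M = anyUpTo? (λ k → 0 <? k ×-dec any? (λ z →
    z ∈? S ×-dec Edge? G z (e k) ×-dec ¬? (z ≟ᶠ e 0) ×-dec ¬? (z ≟ᶠ e M) ×-dec
    (¬? (Edge? G z (e 0)) ⊎-dec ¬? (Edge? G z (e M))))) M

  chord-shortening : ∀ {e M} → EarWalk e M → Chord e M → EarWalkShorterThan M
  chord-shortening {e} ear (j , j<M , i , i<j , chord)
    with m≤n⇒∃[o]m+o≡n i<j | m≤n⇒∃[o]m+o≡n j<M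
  ... | d , refl | r , refl = skip , suc i + r , shorter , record
    { start∈S          = subst (_∈ S) (sym (skip-≤ z≤n)) start∈S
    ; end∈S            = subst (_∈ S) (sym skip-end) end∈S
    ; ends-distinct    = λ p → ends-distinct (trans (sym (skip-≤ z≤n)) (trans p skip-end))
    ; ends-nonadjacent = ends-nonadjacent ∘ subst₂ (Edge G) (skip-≤ z≤n) skip-end
    ; interior∉S       = interior
    ; steps            = step
    }
    where
    open EarWalk ear
    -- cuts out e (suc i) … e (suc i + d)
    skip = joinAt i e (λ t → e (t + suc d))
    skip-≤ = joinAt-≤ i e (λ t → e (t + suc d))
    skip-> = joinAt-> i e (λ t → e (t + suc d))

    +-shuffle : ∀ i r d → suc i + r + suc d ≡ suc (suc i + d) + r
    +-shuffle = solve-∀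

    shorter : suc i + r < suc (suc i + d) + r
    shorter = +-monoˡ-< r (s≤s (m≤m+n (suc i) d))

    skip-end : skip (suc i + r) ≡ e (suc (suc i + d) + r)
    skip-end = trans (skip-> (m≤m+n (suc i) r)) (cong e (+-shuffle i r d))

    i<M : i < suc (suc i + d) + r
    i<M = s≤s (m≤n⇒m≤1+n (≤-trans (m≤m+n i d) (m≤m+n (i + d) r)))

    shifted< : ∀ {t} → t < suc i + r → t + suc d < suc (suc i + d) + r
    shifted< {t} t<M′ = subst (t + suc d <_) (+-shuffle i r d) (+-monoˡ-< (suc d) t<M′)

    interior : ∀ t → 0 < t → t < suc i + r → skip t ∉ S
    interior t 0<t t<M′ with ≤-<-connex t i
    ... | inj₁ t≤i = subst (_∉ S) (sym (skip-≤ t≤i))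
                      (interior∉S t 0<t (≤-<-trans t≤i i<M))
    ... | inj₂ i<t = subst (_∉ S) (sym (skip-> i<t))
                      (interior∉S (t + suc d) (≤-trans 0<t (m≤m+n t (suc d))) (shifted< t<M′))

    step : ∀ t → t < suc i + r → Edge G (skip t) (skip (suc t))
    step t t<M′ with <-cmp t i
    ... | tri< t<i _ _ rewrite skip-≤ (<⇒≤ t<i) | skip-≤ t<i = steps t (<-trans t<i i<M)
    ... | tri≈ _ refl _ rewrite skip-≤ (≤-refl {t}) | skip-> (n<1+n t) | +-suc (suc t) d = chord
    ... | tri> _ _ i<t rewrite skip-> i<t | skip-> (m<n⇒m<1+n i<t) = steps (t + suc d) (shifted< t<M′)

  reverse : ℕ → (ℕ → V G) → ℕ → V G
  reverse M e t = e (M ∸ t)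

  reverse-earWalk : ∀ {e M} → EarWalk e M → EarWalk (reverse M e) M
  reverse-earWalk {e} {M} ear = record
    { start∈S          = end∈S
    ; end∈S            = subst (_∈ S) (sym reverse-end) start∈S
    ; ends-distinct    = λ p → ends-distinct (sym (trans p reverse-end))
    ; ends-nonadjacent = ends-nonadjacent ∘ Edge-sym G ∘ subst (Edge G (e M)) reverse-end
    ; interior∉S       = λ t 0<t t<M →
        interior∉S (M ∸ t) (m<n⇒0<n∸m t<M) (∸-monoʳ-< 0<t (<⇒≤ t<M))
    ; steps            = λ t t<M →
        subst (λ s → Edge G (e s) (e (M ∸ suc t))) (sym (+-∸-assoc 1 t<M))
          (Edge-sym G (steps (M ∸ suc t) (∸-monoʳ-< z<s t<M)))
    }
    where
    open EarWalk ear
    reverse-end : reverse M e M ≡ e 0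
    reverse-end = cong e (n∸n≡0 M)

  earWalk-end-unrepeated : ∀ {e M} → EarWalk e M → ∀ {i} → i < M → e i ≢ e M
  earWalk-end-unrepeated ear {zero}  _   = EarWalk.ends-distinct ear
  earWalk-end-unrepeated ear {suc i} i<M ei≡eM =
    EarWalk.interior∉S ear (suc i) z<s i<M (subst (_∈ S) (sym ei≡eM) (EarWalk.end∈S ear))

  chordless-injective : ∀ {e M} → EarWalk e M → ¬ Chord e M →
    ∀ {i j} → i < j → j ≤ M → e i ≢ e j
  chordless-injective {e} ear ¬chord {i} {j} i<j j≤M ei≡ej with m≤n⇒m<n∨m≡n j≤M
  ... | inj₁ j<M  = ¬chord (j , j<M , i , i<j ,
                      subst (λ v → Edge G v (e (suc j))) (sym ei≡ej) (EarWalk.steps ear j j<M))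
  ... | inj₂ refl = earWalk-end-unrepeated ear i<j ei≡ej

  chordless-consecutive : ∀ {e M} → ¬ Chord e M →
    ∀ {i j} → i < j → j ≤ M → Edge G (e i) (e j) → suc i ≡ j
  chordless-consecutive ¬chord {i} {suc j} i<j j<M ei~ej with m≤n⇒m<n∨m≡n i<j
  ... | inj₁ (s≤s i<j′) = contradiction (j , j<M , i , i<j′ , ei~ej) ¬chord
  ... | inj₂ i+1≡j      = i+1≡j

  ¬stray⇒adjacent-to-ends : ∀ {e M} → ¬ StrayNeighbour e M → ∀ {k z} → k < M → 0 < k →
    z ∈ S → Edge G z (e k) → z ≢ e 0 → z ≢ e M → Edge G z (e 0) × Edge G z (e M)
  ¬stray⇒adjacent-to-ends {e} {M} ¬stray {k} {z} k<M 0<k z∈S z~ek z≢e0 z≢eM =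
    decidable-stable (Edge? G z (e 0)) (stray ∘ inj₁) ,
    decidable-stable (Edge? G z (e M)) (stray ∘ inj₂)
    where
    stray : ¬ (¬ Edge G z (e 0) ⊎ ¬ Edge G z (e M))
    stray nonadjacent = ¬stray (k , k<M , 0<k , z , z∈S , z~ek , z≢e0 , z≢eM , nonadjacent)

  record ReducedEarWalk : Set where
    field
      walk      : ℕ → V G
      length    : ℕ
      earWalk   : EarWalk walk length
      chordless : ¬ Chord walk length
      noStray   : ¬ StrayNeighbour walk length

  module _ (unique : AtMostOneNeighbourIn G S) where

    prefix-shortening : ∀ {e M k z} → EarWalk e M → 0 < k → k < M →
      z ∈ S → Edge G z (e k) → z ≢ e 0 → z ≢ e M → ¬ Edge G z (e 0) →
      EarWalkShorterThan M
    prefix-shortening {e} {M} {k} {z} ear 0<k k<M z∈S z~ek z≢e0 z≢eM z≁e0 =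
      prefix , suc k , k+1<M , record
        { start∈S          = subst (_∈ S) (sym prefix-start) start∈S
        ; end∈S            = subst (_∈ S) (sym prefix-end) z∈S
        ; ends-distinct    = λ p → z≢e0 (sym (trans (sym prefix-start) (trans p prefix-end)))
        ; ends-nonadjacent = z≁e0 ∘ Edge-sym G ∘ subst₂ (Edge G) prefix-start prefix-end
        ; interior∉S       = λ { t 0<t (s≤s t≤k) → subst (_∉ S) (sym (prefix-≤ t≤k))
                                   (interior∉S t 0<t (≤-<-trans t≤k k<M)) }
        ; steps            = step
        }
      where
      open EarWalk ear
      prefix = joinAt k e (λ _ → z)
      prefix-≤ = joinAt-≤ k e (λ _ → z)

      prefix-start : prefix 0 ≡ e 0
      prefix-start = prefix-≤ z≤n

      prefix-end : prefix (suc k) ≡ z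
      prefix-end = joinAt-> k e (λ _ → z) (n<1+n k)

      -- if suc k ≡ M, then z and e M are neighbours in S of the vertex e k outside S
      k+1<M : suc k < M
      k+1<M with m≤n⇒m<n∨m≡n k<M
      ... | inj₁ k+1<M = k+1<M
      ... | inj₂ refl  = contradiction
        (unique (e k) (interior∉S k 0<k k<M) z (e M) z∈S end∈S (Edge-sym G z~ek) (steps k k<M)) z≢eM

      step : ∀ t → t < suc k → Edge G (prefix t) (prefix (suc t))
      step t (s≤s t≤k) with m≤n⇒m<n∨m≡n t≤k
      ... | inj₁ t<k rewrite prefix-≤ t≤k | prefix-≤ t<k = steps t (<-trans t<k k<M)
      ... | inj₂ refl rewrite prefix-≤ t≤k | prefix-end = Edge-sym G z~ek

    strayNeighbour-shortening : ∀ {e M} → EarWalk e M → StrayNeighbour e M → EarWalkShorterThan M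
    strayNeighbour-shortening ear (k , k<M , 0<k , z , z∈S , z~ek , z≢e0 , z≢eM , inj₁ z≁e0) =
      prefix-shortening ear 0<k k<M z∈S z~ek z≢e0 z≢eM z≁e0
    strayNeighbour-shortening {e} {M} ear (k , k<M , 0<k , z , z∈S , z~ek , z≢e0 , z≢eM , inj₂ z≁eM) =
      -- the same shortening, applied to the reversed walk
      prefix-shortening (reverse-earWalk ear) (m<n⇒0<n∸m k<M) (∸-monoʳ-< 0<k (<⇒≤ k<M)) z∈S
        (subst (Edge G z ∘ e) (sym (m∸[m∸n]≡n (<⇒≤ k<M))) z~ek)
        z≢eM (z≢e0 ∘ flip trans (cong e (n∸n≡0 M))) z≁eM

    shorter-or-reduced : ∀ {e M} → EarWalk e M →
      EarWalkShorterThan M ⊎ (¬ Chord e M × ¬ StrayNeighbour e M)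
    shorter-or-reduced {e} {M} ear with chord? e M | strayNeighbour? e M
    ... | yes chord | _         = inj₁ (chord-shortening ear chord)
    ... | no _      | yes stray = inj₁ (strayNeighbour-shortening ear stray)
    ... | no ¬chord | no ¬stray = inj₂ (¬chord , ¬stray)

    reduce : ∀ M e → EarWalk e M → ReducedEarWalk
    reduce = <-rec (λ M → ∀ e → EarWalk e M → ReducedEarWalk) λ M shorten e ear →
      [ (λ (e′ , M′ , M′<M , ear′) → shorten M′<M e′ ear′)
      , (λ (¬chord , ¬stray) → record { earWalk = ear ; chordless = ¬chord ; noStray = ¬stray })
      ] (shorter-or-reduced ear)

    earWalk-length : ∀ {e M} → EarWalk e M → 3 ≤ M
    earWalk-length {M = 0} ear = contradiction refl (EarWalk.ends-distinct ear)
    earWalk-length {M = 1} ear = contradiction (EarWalk.steps ear 0 z<s) (EarWalk.ends-nonadjacent ear)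
    earWalk-length {e} {M = 2} ear = contradiction
      (unique (e 1) (interior∉S 1 z<s (s≤s z<s)) (e 0) (e 2) start∈S end∈S
        (Edge-sym G (steps 0 z<s)) (steps 1 (s≤s z<s)))
      ends-distinct
      where open EarWalk ear
    earWalk-length {M = suc (suc (suc _))} _ = s≤s (s≤s (s≤s z≤n))

  module ReducedEarPath (unique : AtMostOneNeighbourIn G S) (r : ReducedEarWalk) where

    open ReducedEarWalk r renaming (walk to e; length to M)
    open EarWalk earWalk

    walk-injective : ∀ {a b} → a ≤ M → b ≤ M → e a ≡ e b → a ≡ b
    walk-injective {a} {b} a≤M b≤M ea≡eb with <-cmp a b
    ... | tri< a<b _ _ = contradiction ea≡eb (chordless-injective earWalk chordless a<b b≤M)
    ... | tri≈ _ a≡b _ = a≡b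
    ... | tri> _ _ b<a = contradiction (sym ea≡eb) (chordless-injective earWalk chordless b<a a≤M)

    walk-induced : ∀ {a b} → a ≤ M → b ≤ M → Edge G (e a) (e b) → suc a ≡ b ⊎ suc b ≡ a
    walk-induced {a} {b} a≤M b≤M ea~eb with <-cmp a b
    ... | tri< a<b _ _ = inj₁ (chordless-consecutive chordless a<b b≤M ea~eb)
    ... | tri≈ _ refl _ = contradiction ea~eb (Edge-irrefl G)
    ... | tri> _ _ b<a = inj₂ (chordless-consecutive chordless b<a a≤M (Edge-sym G ea~eb))

    path : Path G
    path = record
      { m     = M
      ; vert  = e ∘ toℕ
      ; inj   = λ {i} {j} → toℕ-injective ∘ walk-injective (toℕ≤pred[n] i) (toℕ≤pred[n] j)
      ; steps = λ i → subst (λ t → Edge G (e t) (e (suc (toℕ i)))) (sym (toℕ-inject₁ i))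
                        (steps (toℕ i) (toℕ<n i))
      }

    path-last : last path ≡ e M
    path-last = cong e (toℕ-fromℕ M)

    path-isEar : IsEar G S path
    path-isEar = start∈S , subst (_∈ S) (sym path-last) end∈S ,
      λ i (i≢0 , i≢M) → interior∉S (toℕ i) (n≢0⇒n>0 i≢0) (≤∧≢⇒< (toℕ≤pred[n] i) i≢M)

    path-isInduced : IsInduced path
    path-isInduced i j = walk-induced (toℕ≤pred[n] i) (toℕ≤pred[n] j)

    path-length : 3 ≤ earLength path
    path-length = earWalk-length unique earWalk

    path-ends-nonadjacent : ¬ Edge G (first path) (last path)
    path-ends-nonadjacent = ends-nonadjacent ∘ subst (Edge G (e 0)) path-last

    S-neighbour⇒common-neighbour : ∀ {u} j → u ∈ S → Edge G u (e (toℕ j)) → ¬ (u ∈ S × e (toℕ j) ∈ S) →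
      ¬ PathEdge path u (e (toℕ j)) →
      (u ∈ S × Edge G u (first path) × Edge G u (last path)) × InternalVertex path (e (toℕ j))
    S-neighbour⇒common-neighbour {u} j u∈S u~ej ¬both ¬pathEdge with u ≟ᶠ e 0 | u ≟ᶠ e M
    ... | yes refl | _ =
      contradiction (fzero , j , path-isInduced fzero j u~ej , refl , refl) ¬pathEdge
    ... | no _ | yes refl = contradiction
      (fromℕ M , j , path-isInduced (fromℕ M) j (subst (λ v → Edge G v (e (toℕ j))) (sym path-last) u~ej)
      , path-last , refl) ¬pathEdge
    ... | no u≢e0 | no u≢eM with toℕ j ≟ 0 | toℕ j ≟ M
    ...   | yes j≡0 | _ = contradiction (u∈S , subst (_∈ S) (cong e (sym j≡0)) start∈S) ¬both
    ...   | no _ | yes j≡M = contradiction (u∈S , subst (_∈ S) (cong e (sym j≡M)) end∈S) ¬both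
    ...   | no j≢0 | no j≢M with ¬stray⇒adjacent-to-ends noStray (≤∧≢⇒< (toℕ≤pred[n] j) j≢M) (n≢0⇒n>0 j≢0)
                                    u∈S u~ej u≢e0 u≢eM
    ...     | u~e0 , u~eM = (u∈S , u~e0 , subst (Edge G u) (sym path-last) u~eM) , j , (j≢0 , j≢M) , refl

    path-isStrongInducedEar : IsStrongInducedEar G S path
    path-isStrongInducedEar = path-isEar , path-isInduced , strong
      where
      strong : ∀ u v → (u ∈ S ⊎ OnPath path u) → (v ∈ S ⊎ OnPath path v) → Edge G u v →
        ¬ (u ∈ S × v ∈ S) → ¬ PathEdge path u v →
        ((u ∈ S × Edge G u (first path) × Edge G u (last path)) × InternalVertex path v)
        ⊎ ((v ∈ S × Edge G v (first path) × Edge G v (last path)) × InternalVertex path u)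
      strong _ _ (inj₁ u∈S) (inj₁ v∈S) _ ¬both _ = contradiction (u∈S , v∈S) ¬both
      strong _ _ (inj₂ (i , refl)) (inj₂ (j , refl)) ei~ej _ ¬pathEdge =
        contradiction (i , j , path-isInduced i j ei~ej , refl , refl) ¬pathEdge
      strong u _ (inj₁ u∈S) (inj₂ (j , refl)) u~ej ¬both ¬pathEdge =
        inj₁ (S-neighbour⇒common-neighbour j u∈S u~ej ¬both ¬pathEdge)
      strong _ v (inj₂ (i , refl)) (inj₁ v∈S) ei~v ¬both ¬pathEdge =
        inj₂ (S-neighbour⇒common-neighbour i v∈S (Edge-sym G ei~v) (¬both ∘ swap)
               (¬pathEdge ∘ reverse-pathEdge))
        where
        reverse-pathEdge : PathEdge path v (e (toℕ i)) → PathEdge path (e (toℕ i)) v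
        reverse-pathEdge (i′ , j′ , consecutive , p , q) = j′ , i′ , Sum.swap consecutive , q , p

-- Walks outside S and their attachments

  record OutsideWalk (a b : V G) : Set where
    field
      length   : ℕ
      vertex   : ℕ → V G
      start    : vertex 0 ≡ a
      end      : vertex length ≡ b
      steps    : ∀ t → t < length → Edge G (vertex t) (vertex (suc t))
      vertex∉S : ∀ t → t ≤ length → vertex t ∉ S

    end∉S : b ∉ S
    end∉S = subst (_∉ S) end (vertex∉S length ≤-refl)

  _++ʷ_ : ∀ {a b c} → OutsideWalk a b → OutsideWalk b c → OutsideWalk a c
  w₁ ++ʷ w₂ = record
    { length   = m₁ + m₂
    ; vertex   = joined
    ; start    = trans (joined-≤ z≤n) (OutsideWalk.start w₁)
    ; end      = trans (joined-second m₂) (OutsideWalk.end w₂)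
    ; steps    = step
    ; vertex∉S = out
    }
    where
    open OutsideWalk w₁ renaming (length to m₁; vertex to p)
    open OutsideWalk w₂ using () renaming (length to m₂; vertex to q)
    joined = joinAt m₁ p (λ t → q (t ∸ m₁))
    joined-≤ = joinAt-≤ m₁ p (λ t → q (t ∸ m₁))

    joined-second : ∀ u → joined (m₁ + u) ≡ q u
    joined-second zero rewrite +-identityʳ m₁ =
      trans (joined-≤ ≤-refl) (trans end (sym (OutsideWalk.start w₂)))
    joined-second (suc u) =
      trans (joinAt-> m₁ p (λ t → q (t ∸ m₁)) (m<m+n m₁ z<s)) (cong q (m+n∸m≡n m₁ (suc u)))

    joined-second-suc : ∀ u → joined (suc (m₁ + u)) ≡ q (suc u)
    joined-second-suc u = trans (cong joined (sym (+-suc m₁ u))) (joined-second (suc u))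

    step : ∀ t → t < m₁ + m₂ → Edge G (joined t) (joined (suc t))
    step t t<m with ≤-<-connex m₁ t
    ... | inj₂ t<m₁ rewrite joined-≤ (<⇒≤ t<m₁) | joined-≤ t<m₁ = steps t t<m₁
    ... | inj₁ m₁≤t with m≤n⇒∃[o]m+o≡n m₁≤t
    ...   | u , refl rewrite joined-second u | joined-second-suc u =
      OutsideWalk.steps w₂ u (+-cancelˡ-< m₁ u m₂ t<m)

    out : ∀ t → t ≤ m₁ + m₂ → joined t ∉ S
    out t t≤m with ≤-<-connex m₁ t
    ... | inj₂ t<m₁ rewrite joined-≤ (<⇒≤ t<m₁) = vertex∉S t (<⇒≤ t<m₁)
    ... | inj₁ m₁≤t with m≤n⇒∃[o]m+o≡n m₁≤t
    ...   | u , refl rewrite joined-second u = OutsideWalk.vertex∉S w₂ u (+-cancelˡ-≤ m₁ u m₂ t≤m)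

  earWalk-through : ∀ {x y a b} → x ∈ S → y ∈ S → x ≢ y → ¬ Edge G x y →
    Edge G x a → (w : OutsideWalk a b) → Edge G b y → ∃ λ e → ∃ λ M → EarWalk e M
  earWalk-through {x} {y} x∈S y∈S x≢y x≁y x~a w b~y =
    x ◂ inner , suc (suc m) , record
      { start∈S          = x∈S
      ; end∈S            = subst (_∈ S) (sym inner-end) y∈S
      ; ends-distinct    = x≢y ∘ flip trans inner-end
      ; ends-nonadjacent = x≁y ∘ subst (Edge G x) inner-end
      ; interior∉S       = λ { (suc t) _ (s≤s (s≤s t≤m)) →
                                 subst (_∉ S) (sym (inner-≤ t≤m)) (vertex∉S t t≤m) }
      ; steps            = step
      }
    where
    open OutsideWalk w renaming (length to m; vertex to p)
    inner = joinAt m p (λ _ → y)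
    inner-≤ = joinAt-≤ m p (λ _ → y)

    inner-end : inner (suc m) ≡ y
    inner-end = joinAt-> m p (λ _ → y) (n<1+n m)

    step : ∀ t → t < suc (suc m) → Edge G ((x ◂ inner) t) ((x ◂ inner) (suc t))
    step zero _ rewrite inner-≤ z≤n | start = x~a
    step (suc t) (s≤s (s≤s t≤m)) with m≤n⇒m<n∨m≡n t≤m
    ... | inj₁ t<m  rewrite inner-≤ t≤m | inner-≤ t<m = steps t t<m
    ... | inj₂ refl rewrite inner-≤ t≤m | inner-end | end = b~y

  record Attachment (a : V G) (X : Subset (n G)) : Set where
    field
      vertex      : V G
      vertex∈S    : vertex ∈ S
      vertex∉X    : vertex ∉ X
      exit        : V G
      walk        : OutsideWalk a exit
      exit~vertex : Edge G exit vertex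

  walk-attachment : ∀ {X a s} → a ∉ S → s ∈ S → WalkAvoiding G X a s → Attachment a X
  walk-attachment {X} {a} a∉S s∈S W =
    first-attachment (first-entry (λ t → p t ∈? S) (a∉S ∘ subst (_∈ S) start) m p[m]∈S)
    where
    open WalkAvoiding W
    p : ℕ → V G
    p = vert ∘ clamp m

    p[m]∈S : p m ∈ S
    p[m]∈S = subst (_∈ S) (sym (trans (cong vert (clamp-diag m)) end)) s∈S

    p-step : ∀ t → t < m → Edge G (p t) (p (suc t))
    p-step t t<m with fromℕ< t<m | toℕ-fromℕ< t<m
    ... | i | refl rewrite clamp-inject₁ i | clamp-toℕ m (fsuc i) = steps i

    first-attachment : (∃ λ j → j < m × (∀ t → t ≤ j → p t ∉ S) × p (suc j) ∈ S) → Attachment a X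
    first-attachment (j , j<m , before , p[j+1]∈S) = record
      { vertex      = p (suc j)
      ; vertex∈S    = p[j+1]∈S
      ; vertex∉X    = avoid (clamp m (suc j))
      ; exit        = p j
      ; walk        = record
        { length   = j
        ; vertex   = p
        ; start    = start
        ; end      = refl
        ; steps    = λ t t<j → p-step t (<-trans t<j j<m)
        ; vertex∉S = before
        }
      ; exit~vertex = p-step j j<m
      }

  module _ (connected : ∀ X → ∣ X ∣ < 3 → ConnectedMinus G X) (3≤∣S∣ : 3 ≤ ∣ S ∣) where

    attachment : ∀ X {a} → ∣ X ∣ < 3 → X ⊆ S → a ∉ S → Attachment a X
    attachment X ∣X∣<3 X⊆S a∉S with ∣p∣<∣q∣⇒∃∈q∉p (<-≤-trans ∣X∣<3 3≤∣S∣)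
    ... | s , s∈S , s∉X = walk-attachment a∉S s∈S (connected X ∣X∣<3 _ s (a∉S ∘ X⊆S) s∉X)

    earWalk-exists : ¬ Cycle G 3 → ∀ {w} → w ∉ S → ∃ λ e → ∃ λ M → EarWalk e M
    earWalk-exists ¬triangle w∉S
      with attachment ⊥ (subst (_< 3) (sym (∣⊥∣≡0 (n G))) z<s) (λ x∈⊥ → contradiction x∈⊥ ∉⊥) w∉S
    ... | record { vertex = x₁ ; vertex∈S = x₁∈S ; walk = w₁ ; exit~vertex = a₁~x₁ }
      with attachment ⁅ x₁ ⁆ (subst (_< 3) (sym (∣⁅x⁆∣≡1 x₁)) (s≤s z<s)) (x∈p⇒⁅x⁆⊆p x₁∈S)
             (OutsideWalk.end∉S w₁)
    ... | record { vertex = x₂ ; vertex∈S = x₂∈S ; vertex∉X = x₂∉⁅x₁⁆ ; walk = w₂ ; exit~vertex = a₂~x₂ }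
      with Edge? G x₁ x₂
    ... | no x₁≁x₂ = earWalk-through x₁∈S x₂∈S (x∉⁅y⁆⇒y≢x x₂∉⁅x₁⁆) x₁≁x₂ (Edge-sym G a₁~x₁) w₂ a₂~x₂
    ... | yes x₁~x₂
      with attachment (⁅ x₁ ⁆ ∪ ⁅ x₂ ⁆) (s≤s (∣⁅x⁆∪⁅y⁆∣≤2 x₁ x₂))
             (p⊆r∧q⊆r⇒p∪q⊆r (x∈p⇒⁅x⁆⊆p x₁∈S) (x∈p⇒⁅x⁆⊆p x₂∈S)) (OutsideWalk.end∉S w₂)
    ... | record { vertex = x₃ ; vertex∈S = x₃∈S ; vertex∉X = x₃∉X ; walk = w₃ ; exit~vertex = a₃~x₃ }
      with x∉⁅y⁆∪⁅z⁆⇒y≢x×z≢x x₃∉X | Edge? G x₂ x₃ | Edge? G x₁ x₃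
    ... | _ , x₂≢x₃ | no x₂≁x₃ | _ =
      earWalk-through x₂∈S x₃∈S x₂≢x₃ x₂≁x₃ (Edge-sym G a₂~x₂) w₃ a₃~x₃
    ... | x₁≢x₃ , _ | yes _ | no x₁≁x₃ =
      earWalk-through x₁∈S x₃∈S x₁≢x₃ x₁≁x₃ (Edge-sym G a₁~x₁) (w₂ ++ʷ w₃) a₃~x₃
    ... | x₁≢x₃ , x₂≢x₃ | yes x₂~x₃ | yes x₁~x₃ =
      contradiction (triangle G (x∉⁅y⁆⇒y≢x x₂∉⁅x₁⁆) x₂≢x₃ x₁≢x₃ x₁~x₂ x₂~x₃ x₁~x₃) ¬triangle

proposition5p1 : (G : Graph) → KConnected 3 G → InG2 G →
    (S : Subset (n G)) → (∃ λ v → v ∉ S) → 3 ≤ ∣ S ∣ →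
    (∀ v → v ∉ S → ∀ a b → a ∈ S → b ∈ S → Edge G v a → Edge G v b → a ≡ b) →
    Σ (Path G) λ F → IsStrongInducedEar G S F × 3 ≤ earLength F
      × ¬ Edge G (first F) (last F)
proposition5p1 G (_ , connected) ((_ , shortCycles) , _) S (w , w∉S) 3≤∣S∣ unique =
  strongEar (earWalk-exists connected 3≤∣S∣ (shortCycles 3 (m<m+n 3 z<s)) w∉S)
  where
  open Ears G S

  strongEar : (∃ λ e → ∃ λ M → EarWalk e M) →
    Σ (Path G) λ F → IsStrongInducedEar G S F × 3 ≤ earLength F × ¬ Edge G (first F) (last F)
  strongEar (e , M , ear) = path , path-isStrongInducedEar , path-length , path-ends-nonadjacent
    where open ReducedEarPath unique (reduce unique M e ear)
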